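{- Let $\Sigma$ be an implicational base over a finite set $U$ with closure system $\mathcal{C}$, and let $(U_1,U_2)$ be a split of $\Sigma$. Let $\mathcal{C}_1$ and $\mathcal{C}_2$ be the closure systems (over $U_1$ and $U_2$ respectively) of $\Sigma[U_1]$ and $\Sigma[U_2]$. Then: (1) for every $C\in\mathcal{C}$, $C\cap U_1\in\mathcal{C}_1$ and $C\cap U_2\in\mathcal{C}_2$; hence $\mathcal{C}\subseteq\mathcal{C}_1\times\mathcal{C}_2$; (2) if $\Sigma[U_1,U_2]=\emptyset$, then $\mathcal{C}=\mathcal{C}_1\times\mathcal{C}_2$; (3) if $A\subseteq U_1$ for every implication $A\to b$ of $\Sigma[U_1,U_2]$, then $\mathcal{C}:U_1=\mathcal{C}_1$ and $\mathcal{C}:U_2=\mathcal{C}_2$; (4) if $A\subseteq U_2$ for every implication $A\to b$ of $\Sigma[U_1,U_2]$, then $\mathcal{C}:U_1=\mathcal{C}_1$ and $\mathcal{C}:U_2=\mathcal{C}_2$.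
   Context: An implication over $U$ is written $A \to b$ with $A \subseteq U$ nonempty and $b \in U$; an implicational base over $U$ is a finite set of implications over $U$. A set $C\subseteq U$ satisfies $\Sigma$ if for every $A\to b\in\Sigma$, $A\subseteq C$ implies $b\in C$; the closure system of $\Sigma$ is the family of all subsets of $U$ satisfying $\Sigma$. For $X\subseteq U$, $\Sigma[X]=\{A\to b\in\Sigma: A\cup\{b\}\subseteq X\}$ (a base over $X$). A split of $\Sigma$ is a bipartition $(U_1,U_2)$ of $U$ into two nonempty disjoint sets such that every premise $A$ of an implication of $\Sigma$ satisfies $A\subseteq U_1$ or $A\subseteq U_2$; then $\Sigma[U_1,U_2]:=\Sigma\setminus(\Sigma[U_1]\cup\Sigma[U_2])$. For families $\mathcal{C}_1,\mathcal{C}_2$ over disjoint $U_1,U_2$, the direct product is $\mathcal{C}_1\times\mathcal{C}_2=\{C_1\cup C_2: C_1\in\mathcal{C}_1, C_2\in\mathcal{C}_2\}$. The trace of a family $\mathcal{S}$ on $U'$ is $\mathcal{S}:U'=\{S\cap U' : S\in\mathcal{S}\}$. -}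

module Defs where

open import Data.Nat using (ℕ)
open import Data.Fin using (Fin)
open import Data.Fin.Subset using (Subset; _∈_; _∉_; _⊆_; _∪_; _∩_; ⁅_⁆; Nonempty; ⊥; ⊤)
open import Data.Fin.Subset.Properties using (_⊆?_)
open import Data.List using (List; filter; [])
import Data.List.Membership.Propositional as LM
open import Data.Product using (Σ; ∃; ∃₂; _×_; _,_)
open import Data.Sum using (_⊎_)
open import Relation.Nullary using (¬_)
open import Relation.Nullary.Decidable using (¬?; _×-dec_)
open import Relation.Binary.PropositionalEquality using (_≡_)

-- The finite ground set U is Fin n; subsets of U are Subset n.

record Implication (n : ℕ) : Set where
  constructor _⇒_∣_
  field
    premise    : Subset n
    conclusion : Fin n
    nonempty   : Nonempty premise
open Implication public

Base : ℕ → Set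
Base n = List (Implication n)

_∈ᵢ_ : ∀ {n} → Implication n → Base n → Set
i ∈ᵢ Σ' = i LM.∈ Σ'

Satisfies : ∀ {n} → Base n → Subset n → Set
Satisfies Σ' C = ∀ {i} → i ∈ᵢ Σ' → premise i ⊆ C → conclusion i ∈ C

Family : ℕ → Set₁
Family n = Subset n → Set

ClosureSystemOver : ∀ {n} → Subset n → Base n → Family n
ClosureSystemOver X Σ' C = C ⊆ X × Satisfies Σ' C

ClosureSystem : ∀ {n} → Base n → Family n
ClosureSystem Σ' = ClosureSystemOver ⊤ Σ'

support : ∀ {n} → Implication n → Subset n
support i = premise i ∪ ⁅ conclusion i ⁆

restrict : ∀ {n} → Base n → Subset n → Base n
restrict Σ' X = filter (λ i → support i ⊆? X) Σ'

record IsSplit {n} (Σ' : Base n) (U₁ U₂ : Subset n) : Set where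
  field
    nonempty₁ : Nonempty U₁
    nonempty₂ : Nonempty U₂
    disjoint  : U₁ ∩ U₂ ≡ ⊥
    covers    : U₁ ∪ U₂ ≡ ⊤
    premises  : ∀ {i} → i ∈ᵢ Σ' → premise i ⊆ U₁ ⊎ premise i ⊆ U₂

-- Σ[U₁,U₂] = Σ ∖ (Σ[U₁] ∪ Σ[U₂]): implications of Σ lying in neither Σ[U₁] nor Σ[U₂].
cross : ∀ {n} → Base n → Subset n → Subset n → Base n
cross Σ' U₁ U₂ = filter (λ i → ¬? (support i ⊆? U₁) ×-dec ¬? (support i ⊆? U₂)) Σ'

_⊆F_ : ∀ {n} → Family n → Family n → Set
F ⊆F G = ∀ C → F C → G C

_≡F_ : ∀ {n} → Family n → Family n → Set
F ≡F G = F ⊆F G × G ⊆F F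

_×F_ : ∀ {n} → Family n → Family n → Family n
(F ×F G) C = ∃₂ λ C₁ C₂ → F C₁ × G C₂ × C ≡ C₁ ∪ C₂

trace : ∀ {n} → Family n → Subset n → Family n
trace F X D = ∃ λ S → F S × D ≡ S ∩ X

-- Every premise lies inside U₁ or inside U₂, so an implication of Σ firing inside one
-- block either stays in that block, and is then an implication of Σ[Uₖ], or crosses to
-- the other block. Hence C ∩ Uₖ is Σ[Uₖ]-closed for every Σ-closed C. Under the
-- hypothesis of (3) no implication crosses into U₁ from U₂, i.e. U₂ is itself Σ-closed;
-- then a Σ[U₂]-closed D ⊆ U₂ is Σ-closed, and a Σ[U₁]-closed D ⊆ U₁ extends to the
-- Σ-closed set D ∪ U₂, whose trace on U₁ is D. Case (4) is (3) with the blocks swapped,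
-- and in case (2) both blocks are Σ-closed, so the union of a Σ[U₁]-closed and a
-- Σ[U₂]-closed set is Σ-closed.
module Submission where

open import Defs
open import Data.Fin.Subset using (Subset; _∈_; _∉_; _⊆_; _∩_; _∪_; ⊥; ⊤)
open import Data.Fin.Subset.Properties
  using ( _⊆?_; ∈⊤; ⊆⊤; ⊆-trans; ⊆-reflexive; ⊆-antisym; p∩q⊆p; p∩q⊆q; p⊆p∪q; q⊆p∪q
        ; x∈p∩q⁺; x∈p∪q⁺; x∈p∪q⁻; x∈⁅x⁆; x∈⁅y⁆⇒x≡y; ∉⊥
        ; ∩-comm; ∪-comm; ∩-identityʳ; ∪-identityʳ; ∩-distribˡ-∪; ∩-distribʳ-∪ )
open import Data.List using ([])
open import Data.List.Membership.Propositional.Properties using (∈-filter⁺; ∈-filter⁻)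
open import Data.List.Relation.Unary.Any.Properties using (¬Any[])
open import Data.Product using (_×_; _,_; proj₁; swap)
open import Data.Empty using (⊥-elim)
open import Data.Sum using (_⊎_; inj₁; inj₂) renaming (swap to swap⊎)
open import Relation.Nullary using (¬_; contradiction)
open import Relation.Nullary.Decidable using (¬?; _×-dec_)
open import Relation.Binary.PropositionalEquality
  using (_≡_; refl; sym; trans; subst; cong; cong₂; module ≡-Reasoning)

⊆⇒∩≡ : ∀ {n} {p q : Subset n} → p ⊆ q → p ∩ q ≡ p
⊆⇒∩≡ {p = p} {q} p⊆q = ⊆-antisym (p∩q⊆p p q) (λ x∈p → x∈p∩q⁺ (x∈p , p⊆q x∈p))

⊆-∪-disjointʳ : ∀ {n} {P D Q : Subset n} →
  (∀ {x} → x ∈ P → x ∉ Q) → P ⊆ D ∪ Q → P ⊆ D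
⊆-∪-disjointʳ {D = D} {Q} P#Q P⊆D∪Q {x} x∈P with x∈p∪q⁻ D Q (P⊆D∪Q x∈P)
... | inj₁ x∈D = x∈D
... | inj₂ x∈Q = contradiction x∈Q (P#Q x∈P)

⊆-∪-disjointˡ : ∀ {n} {P D Q : Subset n} →
  (∀ {x} → x ∈ P → x ∉ Q) → P ⊆ Q ∪ D → P ⊆ D
⊆-∪-disjointˡ {D = D} {Q} P#Q P⊆Q∪D =
  ⊆-∪-disjointʳ P#Q (⊆-trans P⊆Q∪D (⊆-reflexive (∪-comm Q D)))

module _ {n} (i : Implication n) {X : Subset n} where

  support⊆ : premise i ⊆ X → conclusion i ∈ X → support i ⊆ X
  support⊆ A⊆X b∈X x∈A∪b with x∈p∪q⁻ (premise i) _ x∈A∪b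
  ... | inj₁ x∈A = A⊆X x∈A
  ... | inj₂ x∈b = subst (_∈ X) (sym (x∈⁅y⁆⇒x≡y _ x∈b)) b∈X

  support⊆⇒premise⊆ : support i ⊆ X → premise i ⊆ X
  support⊆⇒premise⊆ s = ⊆-trans (p⊆p∪q _) s

  support⊆⇒conclusion∈ : support i ⊆ X → conclusion i ∈ X
  support⊆⇒conclusion∈ s = s (q⊆p∪q (premise i) _ (x∈⁅x⁆ (conclusion i)))

module _ {n} {Σ' : Base n} {i : Implication n} where

  ∈-restrict⁺ : ∀ {X} → i ∈ᵢ Σ' → support i ⊆ X → i ∈ᵢ restrict Σ' X
  ∈-restrict⁺ {X} = ∈-filter⁺ (λ j → support j ⊆? X)

  ∈-restrict⁻ : ∀ {X} → i ∈ᵢ restrict Σ' X → i ∈ᵢ Σ' × support i ⊆ X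
  ∈-restrict⁻ {X} = ∈-filter⁻ (λ j → support j ⊆? X)

  ∈-cross⁺ : ∀ {U₁ U₂} → i ∈ᵢ Σ' → ¬ support i ⊆ U₁ → ¬ support i ⊆ U₂ →
    i ∈ᵢ cross Σ' U₁ U₂
  ∈-cross⁺ {U₁} {U₂} i∈Σ s⊈U₁ s⊈U₂ =
    ∈-filter⁺ (λ j → ¬? (support j ⊆? U₁) ×-dec ¬? (support j ⊆? U₂)) i∈Σ (s⊈U₁ , s⊈U₂)

  cross-sym : ∀ {U₁ U₂} → i ∈ᵢ cross Σ' U₁ U₂ → i ∈ᵢ cross Σ' U₂ U₁
  cross-sym {U₁} {U₂} i∈ =
    let i∈Σ , s⊈U₁ , s⊈U₂ =
          ∈-filter⁻ (λ j → ¬? (support j ⊆? U₁) ×-dec ¬? (support j ⊆? U₂)) i∈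
    in ∈-cross⁺ i∈Σ s⊈U₂ s⊈U₁

module _ {n} {Σ' : Base n} where

  ∩-closedOver : ∀ {C} X → Satisfies Σ' C → ClosureSystemOver X (restrict Σ' X) (C ∩ X)
  ∩-closedOver {C} X satC = p∩q⊆q C X , fires
    where
    fires : Satisfies (restrict Σ' X) (C ∩ X)
    fires {i} i∈ A⊆C∩X =
      let i∈Σ , s⊆X = ∈-restrict⁻ i∈
      in x∈p∩q⁺ (satC i∈Σ (⊆-trans A⊆C∩X (p∩q⊆p C X)) , support⊆⇒conclusion∈ i s⊆X)

  trace⊆closedOver : ∀ X → trace (ClosureSystem Σ') X ⊆F ClosureSystemOver X (restrict Σ' X)
  trace⊆closedOver X _ (S , (_ , satS) , refl) = ∩-closedOver X satS

  closedOver-fires : ∀ {X D i} → ClosureSystemOver X (restrict Σ' X) D → i ∈ᵢ Σ' →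
    premise i ⊆ D → conclusion i ∈ X → conclusion i ∈ D
  closedOver-fires {i = i} (D⊆X , satD) i∈Σ A⊆D b∈X =
    satD (∈-restrict⁺ i∈Σ (support⊆ i (⊆-trans A⊆D D⊆X) b∈X)) A⊆D

  closedOver⇒satisfies : ∀ {X D} → Satisfies Σ' X →
    ClosureSystemOver X (restrict Σ' X) D → Satisfies Σ' D
  closedOver⇒satisfies satX d@(D⊆X , _) i∈Σ A⊆D =
    closedOver-fires d i∈Σ A⊆D (satX i∈Σ (⊆-trans A⊆D D⊆X))

  IsSplit-swap : ∀ {U₁ U₂} → IsSplit Σ' U₁ U₂ → IsSplit Σ' U₂ U₁
  IsSplit-swap {U₁} {U₂} split = record
    { nonempty₁ = nonempty₂
    ; nonempty₂ = nonempty₁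
    ; disjoint  = trans (∩-comm U₂ U₁) disjoint
    ; covers    = trans (∪-comm U₂ U₁) covers
    ; premises  = λ i∈Σ → swap⊎ (premises i∈Σ)
    }
    where open IsSplit split

module SplitProperties {n} {Σ' : Base n} {U₁ U₂ : Subset n} (split : IsSplit Σ' U₁ U₂) where

  open IsSplit split

  ∉-disjoint : ∀ {x} → x ∈ U₁ → x ∉ U₂
  ∉-disjoint x∈U₁ x∈U₂ = ∉⊥ (subst (_ ∈_) disjoint (x∈p∩q⁺ (x∈U₁ , x∈U₂)))

  ∈-cover : ∀ x → x ∈ U₁ ⊎ x ∈ U₂
  ∈-cover x = x∈p∪q⁻ U₁ U₂ (subst (x ∈_) (sym covers) ∈⊤)

  premise-not-in-both : ∀ (i : Implication n) → premise i ⊆ U₁ → ¬ premise i ⊆ U₂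
  premise-not-in-both i A⊆U₁ A⊆U₂ = let _ , x∈A = nonempty i in ∉-disjoint (A⊆U₁ x∈A) (A⊆U₂ x∈A)

  ∪-satisfies : ∀ {D₁ D₂} → D₁ ⊆ U₁ → D₂ ⊆ U₂ →
    Satisfies Σ' D₁ → Satisfies Σ' D₂ → Satisfies Σ' (D₁ ∪ D₂)
  ∪-satisfies D₁⊆U₁ D₂⊆U₂ sat₁ sat₂ i∈Σ A⊆D₁∪D₂ with premises i∈Σ
  ... | inj₁ A⊆U₁ = x∈p∪q⁺ (inj₁ (sat₁ i∈Σ (⊆-∪-disjointʳ
          (λ x∈A x∈D₂ → ∉-disjoint (A⊆U₁ x∈A) (D₂⊆U₂ x∈D₂)) A⊆D₁∪D₂)))
  ... | inj₂ A⊆U₂ = x∈p∪q⁺ (inj₂ (sat₂ i∈Σ (⊆-∪-disjointˡ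
          (λ x∈A x∈D₁ → ∉-disjoint (D₁⊆U₁ x∈D₁) (A⊆U₂ x∈A)) A⊆D₁∪D₂)))

  ∪-sink-satisfies : ∀ {D} → Satisfies Σ' U₂ →
    ClosureSystemOver U₁ (restrict Σ' U₁) D → Satisfies Σ' (D ∪ U₂)
  ∪-sink-satisfies satU₂ d {i} i∈Σ A⊆D∪U₂ with premises i∈Σ | ∈-cover (conclusion i)
  ... | inj₂ A⊆U₂ | _         = x∈p∪q⁺ (inj₂ (satU₂ i∈Σ A⊆U₂))
  ... | inj₁ _    | inj₂ b∈U₂ = x∈p∪q⁺ (inj₂ b∈U₂)
  ... | inj₁ A⊆U₁ | inj₁ b∈U₁ = x∈p∪q⁺ (inj₁ (closedOver-fires d i∈Σ A⊆D b∈U₁))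
    where
    A⊆D = ⊆-∪-disjointʳ (λ x∈A → ∉-disjoint (A⊆U₁ x∈A)) A⊆D∪U₂

  sink-satisfies : (∀ {i} → i ∈ᵢ cross Σ' U₁ U₂ → premise i ⊆ U₁) → Satisfies Σ' U₂
  sink-satisfies cross⊆U₁ {i} i∈Σ A⊆U₂ with ∈-cover (conclusion i)
  ... | inj₂ b∈U₂ = b∈U₂
  ... | inj₁ b∈U₁ = ⊥-elim (premise-not-in-both i (cross⊆U₁ (∈-cross⁺ i∈Σ s⊈U₁ s⊈U₂)) A⊆U₂)
    where
    s⊈U₁ : ¬ support i ⊆ U₁
    s⊈U₁ s⊆U₁ = premise-not-in-both i (support⊆⇒premise⊆ i s⊆U₁) A⊆U₂
    s⊈U₂ : ¬ support i ⊆ U₂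
    s⊈U₂ s⊆U₂ = ∉-disjoint b∈U₁ (support⊆⇒conclusion∈ i s⊆U₂)

  ∩∪∩≡ : ∀ C → (C ∩ U₁) ∪ (C ∩ U₂) ≡ C
  ∩∪∩≡ C = begin
    (C ∩ U₁) ∪ (C ∩ U₂) ≡⟨ ∩-distribˡ-∪ C U₁ U₂ ⟨
    C ∩ (U₁ ∪ U₂)       ≡⟨ cong (C ∩_) covers ⟩
    C ∩ ⊤               ≡⟨ ∩-identityʳ C ⟩
    C                   ∎
    where open ≡-Reasoning

  ∪-complement-∩≡ : ∀ {D} → D ⊆ U₁ → (D ∪ U₂) ∩ U₁ ≡ D
  ∪-complement-∩≡ {D} D⊆U₁ = begin
    (D ∪ U₂) ∩ U₁         ≡⟨ ∩-distribʳ-∪ U₁ D U₂ ⟩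
    (D ∩ U₁) ∪ (U₂ ∩ U₁) ≡⟨ cong₂ _∪_ (⊆⇒∩≡ D⊆U₁) (trans (∩-comm U₂ U₁) disjoint) ⟩
    D ∪ ⊥                 ≡⟨ ∪-identityʳ D ⟩
    D                     ∎
    where open ≡-Reasoning

  closure⊆product : ClosureSystem Σ' ⊆F
    (ClosureSystemOver U₁ (restrict Σ' U₁) ×F ClosureSystemOver U₂ (restrict Σ' U₂))
  closure⊆product C (_ , satC) =
    C ∩ U₁ , C ∩ U₂ , ∩-closedOver U₁ satC , ∩-closedOver U₂ satC , sym (∩∪∩≡ C)

  sink⇒trace≡ : Satisfies Σ' U₂ →
    (trace (ClosureSystem Σ') U₁ ≡F ClosureSystemOver U₁ (restrict Σ' U₁))
    × (trace (ClosureSystem Σ') U₂ ≡F ClosureSystemOver U₂ (restrict Σ' U₂))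
  sink⇒trace≡ satU₂ = (trace⊆closedOver U₁ , extend₁) , (trace⊆closedOver U₂ , extend₂)
    where
    extend₁ : ClosureSystemOver U₁ (restrict Σ' U₁) ⊆F trace (ClosureSystem Σ') U₁
    extend₁ D d@(D⊆U₁ , _) =
      D ∪ U₂ , (⊆⊤ , ∪-sink-satisfies satU₂ d) , sym (∪-complement-∩≡ D⊆U₁)
    extend₂ : ClosureSystemOver U₂ (restrict Σ' U₂) ⊆F trace (ClosureSystem Σ') U₂
    extend₂ D d@(D⊆U₂ , _) = D , (⊆⊤ , closedOver⇒satisfies satU₂ d) , sym (⊆⇒∩≡ D⊆U₂)

product⊆closure : ∀ {n} {Σ' : Base n} {U₁ U₂} → IsSplit Σ' U₁ U₂ → cross Σ' U₁ U₂ ≡ [] →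
  (ClosureSystemOver U₁ (restrict Σ' U₁) ×F ClosureSystemOver U₂ (restrict Σ' U₂))
    ⊆F ClosureSystem Σ'
product⊆closure {Σ' = Σ'} {U₁} {U₂} split no-cross _ (D₁ , D₂ , d₁ , d₂ , refl) =
  ⊆⊤ , ∪-satisfies (proj₁ d₁) (proj₁ d₂)
         (closedOver⇒satisfies satU₁ d₁) (closedOver⇒satisfies satU₂ d₂)
  where
  open SplitProperties split
  module Swapped = SplitProperties (IsSplit-swap split)
  ∉-cross : ∀ {i} → ¬ i ∈ᵢ cross Σ' U₁ U₂
  ∉-cross i∈ = ¬Any[] (subst (_ ∈ᵢ_) no-cross i∈)
  satU₁ : Satisfies Σ' U₁
  satU₁ = Swapped.sink-satisfies
    (λ i∈ → contradiction (cross-sym {Σ' = Σ'} {U₁ = U₂} {U₁} i∈) ∉-cross)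
  satU₂ : Satisfies Σ' U₂
  satU₂ = sink-satisfies (λ i∈ → contradiction i∈ ∉-cross)

theorem3 : ∀ {n} (Σ' : Base n) (U₁ U₂ : Subset n) → IsSplit Σ' U₁ U₂ →
    ((∀ C → ClosureSystem Σ' C →
        ClosureSystemOver U₁ (restrict Σ' U₁) (C ∩ U₁) ×
        ClosureSystemOver U₂ (restrict Σ' U₂) (C ∩ U₂))
      × (ClosureSystem Σ' ⊆F (ClosureSystemOver U₁ (restrict Σ' U₁) ×F ClosureSystemOver U₂ (restrict Σ' U₂))))
    × (cross Σ' U₁ U₂ ≡ [] →
        ClosureSystem Σ' ≡F (ClosureSystemOver U₁ (restrict Σ' U₁) ×F ClosureSystemOver U₂ (restrict Σ' U₂)))
    × ((∀ {i} → i ∈ᵢ cross Σ' U₁ U₂ → premise i ⊆ U₁) →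
        (trace (ClosureSystem Σ') U₁ ≡F ClosureSystemOver U₁ (restrict Σ' U₁))
        × (trace (ClosureSystem Σ') U₂ ≡F ClosureSystemOver U₂ (restrict Σ' U₂)))
    × ((∀ {i} → i ∈ᵢ cross Σ' U₁ U₂ → premise i ⊆ U₂) →
        (trace (ClosureSystem Σ') U₁ ≡F ClosureSystemOver U₁ (restrict Σ' U₁))
        × (trace (ClosureSystem Σ') U₂ ≡F ClosureSystemOver U₂ (restrict Σ' U₂)))
theorem3 Σ' U₁ U₂ split =
  ( (λ C (_ , satC) → ∩-closedOver U₁ satC , ∩-closedOver U₂ satC) , closure⊆product )
  , (λ no-cross → closure⊆product , product⊆closure split no-cross)
  , (λ cross⊆U₁ → sink⇒trace≡ (sink-satisfies cross⊆U₁))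
  , (λ cross⊆U₂ → swap (Swapped.sink⇒trace≡ (Swapped.sink-satisfies
      (λ i∈ → cross⊆U₂ (cross-sym {Σ' = Σ'} {U₁ = U₂} {U₁} i∈)))))
  where
  open SplitProperties split
  module Swapped = SplitProperties (IsSplit-swap split)
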